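{- For any command $c$ satisfying $c\parallel\mathbf{term}=c$: $(\mathbf{rely}\,r)\Cap c \sqsubseteq \big((\mathbf{rely}(r\cup r_1))\Cap c\big) \parallel \big((\mathbf{guar}(r\cup r_1))\Cap\mathbf{term}\big)$.
   Context: Shared-memory interpretation of a refinement algebra: commands are ordered by refinement $\sqsubseteq$; program steps $\pi(r)$ and environment steps $\epsilon(r)$ are atomic commands indexed by relations on states, $\pi,\epsilon$ the steps for the universal relation, $\alpha=\pi\sqcap\epsilon$ the least atomic step. Parallel $\parallel$ (identity $\mathbf{skip}=\epsilon^\omega$) and weak conjunction $\Cap$ (identity $\mathbf{chaos}=\alpha^\omega$, idempotent) are abort-strict synchronisation operators, with $\pi(r_1)\parallel\epsilon(r_2)=\pi(r_1\cap r_2)$, $\epsilon(r_1)\parallel\epsilon(r_2)=\epsilon(r_1\cap r_2)$, $\pi(r_1)\parallel\pi(r_2)=\top$, and the interchange axiom $(c_0\parallel d_0)\Cap(c_1\parallel d_1)\sqsubseteq(c_0\Cap c_1)\parallel(d_0\Cap d_1)$. Definitions: $\mathbf{term}=\alpha^\star;\epsilon^\omega$, $\mathbf{guar}\,g=(\pi(g)\sqcap\epsilon)^\omega$, $\mathbf{rely}\,r=(\pi\sqcap\epsilon(r)\sqcap\epsilon(\overline r);\bot)^\omega$. Known facts: relies may be weakened ($r_0\subseteq r_1$ implies $\mathbf{rely}\,r_0\sqsubseteq\mathbf{rely}\,r_1$) and $\mathbf{rely}\,r=(\mathbf{rely}\,r)\parallel(\mathbf{guar}\,r)$. -}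

module Defs where

open import Level using (0ℓ)
open import Data.Unit using (⊤)
open import Data.Sum using (_⊎_)
open import Data.Product using (_×_)
open import Relation.Binary.PropositionalEquality using (_≡_)

Rel : Set → Set₁
Rel S = S → S → Set

_⊆_ : {S : Set} → Rel S → Rel S → Set
r₀ ⊆ r₁ = ∀ {x y} → r₀ x y → r₁ x y

_∩_ : {S : Set} → Rel S → Rel S → Rel S
(r₀ ∩ r₁) x y = r₀ x y × r₁ x y

_∪_ : {S : Set} → Rel S → Rel S → Rel S
(r₀ ∪ r₁) x y = r₀ x y ⊎ r₁ x y

univ : {S : Set} → Rel S
univ _ _ = ⊤

∁ : {S : Set} → Rel S → Rel S
∁ r x y = r x y → Data.Empty.⊥
  where import Data.Empty

-- Commands form a lattice under refinement ⊑ (c ⊑ d : d refines c),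
-- with nondeterministic choice ⊓ as meet, abort ⊥ least, magic ⊤ greatest.
record SharedMemoryAlgebra (State : Set) : Set₁ where
  infix  4 _⊑_
  infixl 6 _⊓_
  infixr 7 _⨾_
  infixr 5 _∥_ _⋒_
  field
    Cmd   : Set
    _⊑_   : Cmd → Cmd → Set
    ⊑-refl    : ∀ {c} → c ⊑ c
    ⊑-trans   : ∀ {c d e} → c ⊑ d → d ⊑ e → c ⊑ e
    ⊑-antisym : ∀ {c d} → c ⊑ d → d ⊑ c → c ≡ d

    _⊓_   : Cmd → Cmd → Cmd
    ⊓-lowerˡ : ∀ {c d} → c ⊓ d ⊑ c
    ⊓-lowerʳ : ∀ {c d} → c ⊓ d ⊑ d
    ⊓-glb    : ∀ {c d e} → e ⊑ c → e ⊑ d → e ⊑ c ⊓ d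

    abort : Cmd
    magic : Cmd
    abort-least    : ∀ {c} → abort ⊑ c
    magic-greatest : ∀ {c} → c ⊑ magic

    nil   : Cmd
    _⨾_   : Cmd → Cmd → Cmd
    ⨾-assoc  : ∀ {c d e} → (c ⨾ d) ⨾ e ≡ c ⨾ (d ⨾ e)
    ⨾-nilˡ   : ∀ {c} → nil ⨾ c ≡ c
    ⨾-nilʳ   : ∀ {c} → c ⨾ nil ≡ c
    ⨾-abortˡ : ∀ {c} → abort ⨾ c ≡ abort
    ⨾-mono   : ∀ {c c' d d'} → c ⊑ c' → d ⊑ d' → c ⨾ d ⊑ c' ⨾ d'

    _ω : Cmd → Cmd
    _⋆ : Cmd → Cmd
    ω-unfold : ∀ {c} → c ω ≡ nil ⊓ c ⨾ c ω
    ω-induct : ∀ {c x} → nil ⊓ c ⨾ x ⊑ x → c ω ⊑ x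
    ⋆-unfold : ∀ {c} → c ⋆ ≡ nil ⊓ c ⨾ c ⋆
    ⋆-induct : ∀ {c x} → x ⊑ nil ⊓ c ⨾ x → x ⊑ c ⋆

    -- atomic program and environment steps indexed by relations
    π ε : Rel State → Cmd
    π-mono : ∀ {r₀ r₁} → r₀ ⊆ r₁ → π r₁ ⊑ π r₀
    ε-mono : ∀ {r₀ r₁} → r₀ ⊆ r₁ → ε r₁ ⊑ ε r₀

    -- parallel and weak conjunction (abort-strict synchronisation operators)
    _∥_ _⋒_ : Cmd → Cmd → Cmd
    ∥-assoc : ∀ {c d e} → (c ∥ d) ∥ e ≡ c ∥ (d ∥ e)
    ∥-comm  : ∀ {c d} → c ∥ d ≡ d ∥ c
    ∥-mono  : ∀ {c c' d d'} → c ⊑ c' → d ⊑ d' → c ∥ d ⊑ c' ∥ d'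
    ∥-abort : ∀ {c} → c ∥ abort ≡ abort
    ⋒-assoc : ∀ {c d e} → (c ⋒ d) ⋒ e ≡ c ⋒ (d ⋒ e)
    ⋒-comm  : ∀ {c d} → c ⋒ d ≡ d ⋒ c
    ⋒-mono  : ∀ {c c' d d'} → c ⊑ c' → d ⊑ d' → c ⋒ d ⊑ c' ⋒ d'
    ⋒-abort : ∀ {c} → c ⋒ abort ≡ abort
    ⋒-idem  : ∀ {c} → c ⋒ c ≡ c

    ∥-π-ε : ∀ {r₁ r₂} → π r₁ ∥ ε r₂ ≡ π (r₁ ∩ r₂)
    ∥-ε-ε : ∀ {r₁ r₂} → ε r₁ ∥ ε r₂ ≡ ε (r₁ ∩ r₂)
    ∥-π-π : ∀ {r₁ r₂} → π r₁ ∥ π r₂ ≡ magic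

    interchange : ∀ {c₀ c₁ d₀ d₁} →
      (c₀ ∥ d₀) ⋒ (c₁ ∥ d₁) ⊑ (c₀ ⋒ c₁) ∥ (d₀ ⋒ d₁)

    -- identities: skip = ε ω for ∥, chaos = α ω for ⋒ (written out in full)
    ∥-skipʳ  : ∀ {c} → c ∥ (ε univ) ω ≡ c
    ⋒-chaosʳ : ∀ {c} → c ⋒ (π univ ⊓ ε univ) ω ≡ c
    -- known facts (from the context), with rely r written out in full
    rely-weaken : ∀ {r₀ r₁} → r₀ ⊆ r₁ →
      (π univ ⊓ ε r₀ ⊓ ε (∁ r₀) ⨾ abort) ω ⊑ (π univ ⊓ ε r₁ ⊓ ε (∁ r₁) ⨾ abort) ω
    rely-guar   : ∀ {r} →
      (π univ ⊓ ε r ⊓ ε (∁ r) ⨾ abort) ω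
        ≡ (π univ ⊓ ε r ⊓ ε (∁ r) ⨾ abort) ω ∥ (π r ⊓ ε univ) ω

module Derived {State : Set} (A : SharedMemoryAlgebra State) where
  open SharedMemoryAlgebra A public

  πU εU α : Cmd
  πU = π univ
  εU = ε univ
  α  = πU ⊓ εU

  skip chaos term : Cmd
  skip  = εU ω
  chaos = α ω
  term  = α ⋆ ⨾ εU ω

  guar : Rel State → Cmd
  guar g = (π g ⊓ εU) ω

  rely : Rel State → Cmd
  rely r = (πU ⊓ ε r ⊓ ε (∁ r) ⨾ abort) ω

module Submission where

open import Defs
open import Relation.Binary.PropositionalEquality using (_≡_; subst; sym; cong₂)
open import Data.Sum using (inj₁)

-- Split rely r into rely r ∥ guar r and c into c ∥ d, then regroup by interchange.
rely-⋒-split : {State : Set} (A : SharedMemoryAlgebra State) →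
  let open Derived A in
  ∀ (r : Rel State) {c d : Cmd} → c ∥ d ≡ c →
  rely r ⋒ c ⊑ (rely r ⋒ c) ∥ (guar r ⋒ d)
rely-⋒-split A r {c} {d} c∥d≡c =
  subst (_⊑ (rely r ⋒ c) ∥ (guar r ⋒ d)) split interchange
  where
  open Derived A
  split : (rely r ∥ guar r) ⋒ (c ∥ d) ≡ rely r ⋒ c
  split = cong₂ _⋒_ (sym rely-guar) c∥d≡c

mainTheorem17 : {State : Set} (A : SharedMemoryAlgebra State) →
    let open Derived A in
    ∀ (r r₁ : Rel State) (c : Cmd) → c ∥ term ≡ c →
    rely r ⋒ c ⊑ (rely (r ∪ r₁) ⋒ c) ∥ (guar (r ∪ r₁) ⋒ term)
mainTheorem17 A r r₁ c c∥term≡c =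
  ⊑-trans (⋒-mono (rely-weaken inj₁) ⊑-refl)
          (rely-⋒-split A (r ∪ r₁) c∥term≡c)
  where open Derived A
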